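{- Let $k\ge2$, let $\mathcal{T}$ be a $k$-star and let $\alpha_e\ne0$ for every $e\in E(\mathcal{T})$. If $\{\alpha_e\}_{e\in E(\mathcal{T})}$ is a root of $\widetilde\mu(\mathcal{T},\{x_e\}_{e\in E(\mathcal{T})})$, then $\mathcal{T}$ is generalized $\{\alpha_e\}_{e\in E(\mathcal{T})}$-normal.
   Context: A $k$-graph has a finite vertex set and an edge set of $k$-element vertex subsets. A $k$-star is a $k$-graph consisting of edges that pairwise intersect exactly in one common vertex. For a $k$-forest $\mathcal{T}$ (a $k$-graph without cycles) with set of matchings $\mathcal{M}(\mathcal{T})$ (sets of pairwise disjoint edges, including $\emptyset$), $\widetilde\mu(\mathcal{T},\{x_e\}_{e\in E(\mathcal{T})})=\sum_{M\in\mathcal{M}(\mathcal{T})}(-1)^{|M|}\prod_{e\in M}x_e$. A weighted incidence matrix of a $k$-graph $\mathcal{H}$ is a complex matrix $B$ indexed by $V(\mathcal{H})\times E(\mathcal{H})$ with $B(v,e)\ne0$ iff $v\in e$. For nonzero complex $\{\alpha_e\}$, $\mathcal{H}$ is generalized $\{\alpha_e\}_{e\in E(\mathcal{H})}$-normal if there is a weighted incidence matrix $B$ with $\sum_{e\ni v}B(v,e)=1$ for every vertex $v$ and $\prod_{v\in e}B(v,e)=\alpha_e$ for every edge $e$. -}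

module Defs where

open import Level using (Level; _⊔_)
open import Algebra.Bundles using (CommutativeRing)
open import Data.Nat using (ℕ; zero; suc)
open import Data.Bool using (Bool; true; false; if_then_else_; _∧_; _∨_; not)
open import Data.Fin using (Fin; zero; suc)
open import Data.Fin.Subset using (Subset; _∈_; ∣_∣)
open import Data.Vec using (Vec; []; _∷_; lookup)
open import Data.List using (List; []; _∷_; map; _++_; foldr; filter)
open import Data.Product using (Σ; ∃; _×_; _,_)
open import Relation.Nullary using (¬_)
open import Relation.Binary.PropositionalEquality using (_≡_)
open import Relation.Nullary.Decidable using (Dec; yes; no)
open import Data.Bool.Properties using (T?)
open import Data.Bool using (T)

-- Finite k-graphs.
-- A k-graph with vertex set Fin n and m edges is given by an
-- injective family  E : Fin m → Subset n  of k-element vertex subsets.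
-- (Injectivity: the edge set is a *set*.)

record IsKGraph (k n m : ℕ) (E : Fin m → Subset n) : Set where
  field
    edge-size : ∀ e → ∣ E e ∣ ≡ k
    edges-distinct : ∀ e f → E e ≡ E f → e ≡ f

IsKStar : (k n m : ℕ) → (Fin m → Subset n) → Set
IsKStar k n m E =
  IsKGraph k n m E ×
  (∀ (v : Fin n) → ∃ λ e → v ∈ E e) ×
  (∃ λ (c : Fin n) →
     (∀ e → c ∈ E e) ×
     (∀ e f → ¬ (e ≡ f) → ∀ v → v ∈ E e → v ∈ E f → v ≡ c))

anyFin : ∀ {n} → (Fin n → Bool) → Bool
anyFin {zero} p = false
anyFin {suc n} p = p zero ∨ anyFin (λ i → p (suc i))

allFin : ∀ {n} → (Fin n → Bool) → Bool
allFin {zero} p = true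
allFin {suc n} p = p zero ∧ allFin (λ i → p (suc i))

eqFin : ∀ {n} → Fin n → Fin n → Bool
eqFin zero zero = true
eqFin zero (suc j) = false
eqFin (suc i) zero = false
eqFin (suc i) (suc j) = eqFin i j

allSubsets : ∀ m → List (Subset m)
allSubsets zero = [] ∷ []
allSubsets (suc m) = map (false ∷_) (allSubsets m) ++ map (true ∷_) (allSubsets m)

isMatching : ∀ {n m} → (Fin m → Subset n) → Subset m → Bool
isMatching {n} {m} E M =
  allFin λ e → allFin λ f →
    not (lookup M e ∧ lookup M f ∧ not (eqFin e f)
         ∧ anyFin (λ v → lookup (E e) v ∧ lookup (E f) v))

matchings : ∀ {n m} → (Fin m → Subset n) → List (Subset m)
matchings {n} {m} E = filter (λ M → T? (isMatching E M)) (allSubsets m)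

module _ {c ℓ : Level} (R : CommutativeRing c ℓ) where
  open CommutativeRing R using (Carrier; _≈_; _+_; _*_; -_; 0#; 1#)

  record IsField : Set (c ⊔ ℓ) where
    field
      1≉0 : ¬ (1# ≈ 0#)
      inverse : ∀ x → ¬ (x ≈ 0#) → ∃ λ y → x * y ≈ 1#

  sumFin : ∀ {n} → (Fin n → Carrier) → Carrier
  sumFin {zero} f = 0#
  sumFin {suc n} f = f zero + sumFin (λ i → f (suc i))

  prodFin : ∀ {n} → (Fin n → Carrier) → Carrier
  prodFin {zero} f = 1#
  prodFin {suc n} f = f zero * prodFin (λ i → f (suc i))

  -- (-1)^|M| ∏_{e∈M} x_e
  matchingTerm : ∀ {m} → (Fin m → Carrier) → Subset m → Carrier
  matchingTerm x M = prodFin (λ e → if lookup M e then - (x e) else 1#)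

  μ̃ : ∀ {n m} → (Fin m → Subset n) → (Fin m → Carrier) → Carrier
  μ̃ E x = foldr (λ M acc → matchingTerm x M + acc) 0# (matchings E)

  IsWeightedIncidence : ∀ {n m} → (Fin m → Subset n) → (Fin n → Fin m → Carrier) → Set ℓ
  IsWeightedIncidence {n} {m} E B =
    ∀ (v : Fin n) (e : Fin m) → (¬ (B v e ≈ 0#) → v ∈ E e) × (v ∈ E e → ¬ (B v e ≈ 0#))

  GeneralizedNormal : ∀ {n m} → (Fin m → Subset n) → (Fin m → Carrier) → Set (c ⊔ ℓ)
  GeneralizedNormal {n} {m} E α =
    ∃ λ (B : Fin n → Fin m → Carrier) →
      IsWeightedIncidence E B ×
      (∀ v → sumFin (λ e → if lookup (E e) v then B v e else 0#) ≈ 1#) ×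
      (∀ e → prodFin (λ v → if lookup (E e) v then B v e else 1#) ≈ α e)

{-# OPTIONS --safe #-}
-- In a star every edge contains the centre, so the matchings are exactly ∅
-- and the single edges, and μ̃ = 1 - Σₑ xₑ. A root {αₑ} therefore has
-- Σₑ αₑ = 1, and the weighted incidence matrix putting αₑ at the centre of
-- each edge and 1 at every other vertex of it is normal: the centre's row
-- sums to Σₑ αₑ = 1, every other vertex lies in exactly one edge, and each
-- edge's product is αₑ · 1 ⋯ 1.
module Submission where

open import Defs
open import Level using (Level)
open import Algebra.Bundles using (CommutativeRing; Monoid)
open import Data.Nat using (ℕ; _≥_; zero; suc)
open import Data.Fin using (Fin; zero; suc; _≟_)
open import Data.Fin.Properties using (suc-injective; 0≢1+n)
open import Data.Fin.Subset using (Subset; _∈_; _∉_; ⊥; ⁅_⁆)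
open import Data.Bool using (Bool; true; false; if_then_else_; _∧_; not)
open import Data.Bool.Properties using (T?)
open import Data.Vec using ([]; _∷_; lookup)
open import Data.Vec.Properties using ([]=⇒lookup; lookup⇒[]=)
open import Data.Vec.Functional using (Vector)
open import Data.List using (List; []; _∷_; map; _++_; foldr; filter)
open import Data.Product using (∃; _,_)
open import Data.Empty using (⊥-elim)
open import Function using (_∘_)
open import Relation.Nullary using (¬_; yes; no)
open import Relation.Binary.PropositionalEquality
  using (_≡_; _≢_; refl; cong; cong₂)
import Algebra.Properties.Monoid.Sum as MonoidSum
import Algebra.Properties.Ring as RingProperties
import Algebra.Properties.Group as GroupProperties
import Relation.Binary.Reasoning.Setoid as SetoidReasoning

allFin-elim : ∀ {n} (p : Fin n → Bool) → allFin p ≡ true → ∀ i → p i ≡ true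
allFin-elim p h zero with p zero | h
... | true | _ = refl
allFin-elim p h (suc i) with p zero | h
... | true | h′ = allFin-elim (p ∘ suc) h′ i

allFin-intro : ∀ {n} (p : Fin n → Bool) → (∀ i → p i ≡ true) → allFin p ≡ true
allFin-intro {zero} p h = refl
allFin-intro {suc n} p h with p zero | h zero
... | true | _ = allFin-intro (p ∘ suc) (h ∘ suc)

anyFin-intro : ∀ {n} (p : Fin n → Bool) i → p i ≡ true → anyFin p ≡ true
anyFin-intro p zero h with p zero | h
... | true | _ = refl
anyFin-intro p (suc i) h with p zero
... | true = refl
... | false = anyFin-intro (p ∘ suc) i h

eqFin-refl : ∀ {n} (i : Fin n) → eqFin i i ≡ true
eqFin-refl zero = refl
eqFin-refl (suc i) = eqFin-refl i

eqFin-sound : ∀ {n} (i j : Fin n) → eqFin i j ≡ true → i ≡ j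
eqFin-sound zero zero h = refl
eqFin-sound (suc i) (suc j) h = cong suc (eqFin-sound i j h)

eqFin-≢ : ∀ {n} (i j : Fin n) → i ≢ j → eqFin i j ≡ false
eqFin-≢ i j i≢j with eqFin i j in eq
... | false = refl
... | true = ⊥-elim (i≢j (eqFin-sound i j eq))

≡true-ext : ∀ {a b} → (a ≡ true → b ≡ true) → (b ≡ true → a ≡ true) → a ≡ b
≡true-ext {false} {false} _ _ = refl
≡true-ext {false} {true}  _ b⇒a with b⇒a refl
... | ()
≡true-ext {true}  {false} a⇒b _ with a⇒b refl
... | ()
≡true-ext {true}  {true}  _ _ = refl

emptyᵇ : ∀ {m} → Subset m → Bool
emptyᵇ [] = true
emptyᵇ (false ∷ M) = emptyᵇ M
emptyᵇ (true ∷ M) = false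

atMostOneᵇ : ∀ {m} → Subset m → Bool
atMostOneᵇ [] = true
atMostOneᵇ (false ∷ M) = atMostOneᵇ M
atMostOneᵇ (true ∷ M) = emptyᵇ M

AtMostOne : ∀ {m} → Subset m → Set
AtMostOne M = ∀ e f → lookup M e ≡ true → lookup M f ≡ true → e ≡ f

emptyᵇ-sound : ∀ {m} (M : Subset m) → emptyᵇ M ≡ true → ∀ e → lookup M e ≢ true
emptyᵇ-sound (false ∷ M) h (suc e) = emptyᵇ-sound M h e

emptyᵇ-complete : ∀ {m} (M : Subset m) → (∀ e → lookup M e ≢ true) → emptyᵇ M ≡ true
emptyᵇ-complete [] h = refl
emptyᵇ-complete (false ∷ M) h = emptyᵇ-complete M (h ∘ suc)
emptyᵇ-complete (true ∷ M) h = ⊥-elim (h zero refl)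

atMostOneᵇ-sound : ∀ {m} (M : Subset m) → atMostOneᵇ M ≡ true → AtMostOne M
atMostOneᵇ-sound (true ∷ M) h zero zero _ _ = refl
atMostOneᵇ-sound (true ∷ M) h zero (suc f) _ Mf = ⊥-elim (emptyᵇ-sound M h f Mf)
atMostOneᵇ-sound (true ∷ M) h (suc e) f Me _ = ⊥-elim (emptyᵇ-sound M h e Me)
atMostOneᵇ-sound (false ∷ M) h (suc e) (suc f) Me Mf =
  cong suc (atMostOneᵇ-sound M h e f Me Mf)

atMostOneᵇ-complete : ∀ {m} (M : Subset m) → AtMostOne M → atMostOneᵇ M ≡ true
atMostOneᵇ-complete [] h = refl
atMostOneᵇ-complete (false ∷ M) h =
  atMostOneᵇ-complete M λ e f Me Mf → suc-injective (h (suc e) (suc f) Me Mf)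
atMostOneᵇ-complete (true ∷ M) h = emptyᵇ-complete M λ e Me → 0≢1+n (h zero (suc e) refl Me)

atMostOne⇒isMatching : ∀ {n m} (E : Fin m → Subset n) (M : Subset m) →
  AtMostOne M → isMatching E M ≡ true
atMostOne⇒isMatching E M atMostOne =
  allFin-intro _ λ e → allFin-intro _ λ f → entry e f
  where
  entry : ∀ e f → not (lookup M e ∧ lookup M f ∧ not (eqFin e f)
                       ∧ anyFin (λ v → lookup (E e) v ∧ lookup (E f) v)) ≡ true
  entry e f with lookup M e in Me | lookup M f in Mf
  ... | false | _ = refl
  ... | true | false = refl
  ... | true | true rewrite atMostOne e f Me Mf | eqFin-refl f = refl

isMatching⇒atMostOne : ∀ {n m} (E : Fin m → Subset n) (c : Fin n) → (∀ e → c ∈ E e) →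
  ∀ M → isMatching E M ≡ true → AtMostOne M
isMatching⇒atMostOne E c c∈E M matching e f Me Mf =
  eqFin-sound e f (conclude Me Mf shared (allFin-elim _ (allFin-elim _ matching e) f))
  where
  shared : anyFin (λ v → lookup (E e) v ∧ lookup (E f) v) ≡ true
  shared = anyFin-intro _ c (cong₂ _∧_ ([]=⇒lookup (c∈E e)) ([]=⇒lookup (c∈E f)))
  conclude : ∀ {a b d s} → a ≡ true → b ≡ true → s ≡ true →
             not (a ∧ b ∧ not d ∧ s) ≡ true → d ≡ true
  conclude {d = true} refl refl refl _ = refl
  conclude {d = false} refl refl refl ()

isMatching-commonVertex : ∀ {n m} (E : Fin m → Subset n) (c : Fin n) → (∀ e → c ∈ E e) →
  ∀ M → isMatching E M ≡ atMostOneᵇ M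
isMatching-commonVertex E c c∈E M = ≡true-ext
  (atMostOneᵇ-complete M ∘ isMatching⇒atMostOne E c c∈E M)
  (atMostOne⇒isMatching E M ∘ atMostOneᵇ-sound M)

module _ {a ℓ} (M : Monoid a ℓ) where
  open Monoid M
  open MonoidSum M using (sum; sum-cong-≋; sum-replicate-zero)

  sum-concentrated : ∀ {n} (i : Fin n) (t : Vector Carrier n) →
    (∀ j → j ≢ i → t j ≈ ε) → sum t ≈ t i
  sum-concentrated {suc n} zero t t≈ε = trans
    (∙-congˡ (trans (sum-cong-≋ (λ j → t≈ε (suc j) λ ())) (sum-replicate-zero n)))
    (identityʳ _)
  sum-concentrated (suc i) t t≈ε = trans
    (∙-congʳ (t≈ε zero λ ()))
    (trans (identityˡ _) (sum-concentrated i (t ∘ suc) λ j j≢i → t≈ε (suc j) (j≢i ∘ suc-injective)))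

module _ {r ℓ} (K : CommutativeRing r ℓ) where
  open CommutativeRing K hiding (zero) renaming (refl to ≈-refl)
  open SetoidReasoning setoid
  open RingProperties ring using (-‿+-comm)

  sumFin≡sum : ∀ {n} (f : Fin n → Carrier) → sumFin K f ≡ MonoidSum.sum +-monoid f
  sumFin≡sum {zero} f = refl
  sumFin≡sum {suc n} f = cong (f zero +_) (sumFin≡sum (f ∘ suc))

  prodFin≡sum : ∀ {n} (f : Fin n → Carrier) → prodFin K f ≡ MonoidSum.sum *-monoid f
  prodFin≡sum {zero} f = refl
  prodFin≡sum {suc n} f = cong (f zero *_) (prodFin≡sum (f ∘ suc))

  sumFin-concentrated : ∀ {n} (i : Fin n) (f : Fin n → Carrier) →
    (∀ j → j ≢ i → f j ≈ 0#) → sumFin K f ≈ f i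
  sumFin-concentrated i f f≈0 =
    trans (reflexive (sumFin≡sum f)) (sum-concentrated +-monoid i f f≈0)

  prodFin-concentrated : ∀ {n} (i : Fin n) (f : Fin n → Carrier) →
    (∀ j → j ≢ i → f j ≈ 1#) → prodFin K f ≈ f i
  prodFin-concentrated i f f≈1 =
    trans (reflexive (prodFin≡sum f)) (sum-concentrated *-monoid i f f≈1)

  sumFin-cong : ∀ {n} {f g : Fin n → Carrier} → (∀ i → f i ≈ g i) → sumFin K f ≈ sumFin K g
  sumFin-cong {zero} f≈g = ≈-refl
  sumFin-cong {suc n} f≈g = +-cong (f≈g zero) (sumFin-cong (f≈g ∘ suc))

  sumFin-neg : ∀ {n} (f : Fin n → Carrier) → sumFin K (λ i → - f i) ≈ - sumFin K f
  sumFin-neg {zero} f = sym (RingProperties.-0#≈0# ring)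
  sumFin-neg {suc n} f = trans (+-congˡ (sumFin-neg (f ∘ suc))) (-‿+-comm _ _)

  sumList : ∀ {m} → (Subset m → Carrier) → List (Subset m) → Carrier
  sumList f = foldr (λ M acc → f M + acc) 0#

  sumList-filter : ∀ {m} (f : Subset m → Carrier) (p : Subset m → Bool) xs →
    sumList f (filter (T? ∘ p) xs) ≈ sumList (λ M → if p M then f M else 0#) xs
  sumList-filter f p [] = ≈-refl
  sumList-filter f p (x ∷ xs) with p x
  ... | true = +-congˡ (sumList-filter f p xs)
  ... | false = trans (sumList-filter f p xs) (sym (+-identityˡ _))

  sumList-++ : ∀ {m} (f : Subset m → Carrier) xs ys →
    sumList f (xs ++ ys) ≈ sumList f xs + sumList f ys
  sumList-++ f [] ys = sym (+-identityˡ _)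
  sumList-++ f (x ∷ xs) ys = trans (+-congˡ (sumList-++ f xs ys)) (sym (+-assoc _ _ _))

  sumList-map : ∀ {m m′} (f : Subset m → Carrier) (g : Subset m′ → Subset m) xs →
    sumList f (map g xs) ≡ sumList (f ∘ g) xs
  sumList-map f g [] = refl
  sumList-map f g (x ∷ xs) = cong (f (g x) +_) (sumList-map f g xs)

  sumList-cong : ∀ {m} {f g : Subset m → Carrier} xs → (∀ M → f M ≈ g M) →
    sumList f xs ≈ sumList g xs
  sumList-cong [] f≈g = ≈-refl
  sumList-cong (x ∷ xs) f≈g = +-cong (f≈g x) (sumList-cong xs f≈g)

  sumList-zero : ∀ {m} (xs : List (Subset m)) → sumList (λ _ → 0#) xs ≈ 0#
  sumList-zero [] = ≈-refl
  sumList-zero (x ∷ xs) = trans (+-identityˡ _) (sumList-zero xs)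

  sumList-allSubsets : ∀ {m} (f : Subset (suc m) → Carrier) →
    sumList f (allSubsets (suc m)) ≈
    sumList (f ∘ (false ∷_)) (allSubsets m) + sumList (f ∘ (true ∷_)) (allSubsets m)
  sumList-allSubsets {m} f = trans
    (sumList-++ f (map (false ∷_) (allSubsets m)) (map (true ∷_) (allSubsets m)))
    (reflexive (cong₂ _+_ (sumList-map f (false ∷_) (allSubsets m))
                          (sumList-map f (true ∷_) (allSubsets m))))

  sumList-emptyᵇ : ∀ {m} (f : Subset m → Carrier) →
    sumList (λ M → if emptyᵇ M then f M else 0#) (allSubsets m) ≈ f ⊥
  sumList-emptyᵇ {zero} f = +-identityʳ _
  sumList-emptyᵇ {suc m} f = begin
    sumList (λ M → if emptyᵇ M then f M else 0#) (allSubsets (suc m))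
      ≈⟨ sumList-allSubsets (λ M → if emptyᵇ M then f M else 0#) ⟩
    sumList (λ M → if emptyᵇ M then f (false ∷ M) else 0#) (allSubsets m)
      + sumList (λ _ → 0#) (allSubsets m)
      ≈⟨ +-cong (sumList-emptyᵇ (f ∘ (false ∷_))) (sumList-zero (allSubsets m)) ⟩
    f ⊥ + 0#
      ≈⟨ +-identityʳ _ ⟩
    f ⊥
      ∎

  sumList-atMostOneᵇ : ∀ {m} (f : Subset m → Carrier) →
    sumList (λ M → if atMostOneᵇ M then f M else 0#) (allSubsets m) ≈
    f ⊥ + sumFin K (λ e → f ⁅ e ⁆)
  sumList-atMostOneᵇ {zero} f = ≈-refl
  sumList-atMostOneᵇ {suc m} f = begin
    sumList (λ M → if atMostOneᵇ M then f M else 0#) (allSubsets (suc m))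
      ≈⟨ sumList-allSubsets (λ M → if atMostOneᵇ M then f M else 0#) ⟩
    sumList (λ M → if atMostOneᵇ M then f (false ∷ M) else 0#) (allSubsets m)
      + sumList (λ M → if emptyᵇ M then f (true ∷ M) else 0#) (allSubsets m)
      ≈⟨ +-cong (sumList-atMostOneᵇ (f ∘ (false ∷_))) (sumList-emptyᵇ (f ∘ (true ∷_))) ⟩
    (f ⊥ + S) + f ⁅ zero ⁆
      ≈⟨ +-assoc _ _ _ ⟩
    f ⊥ + (S + f ⁅ zero ⁆)
      ≈⟨ +-congˡ (+-comm _ _) ⟩
    f ⊥ + (f ⁅ zero ⁆ + S)
      ∎
    where
    S = sumFin K (λ e → f ⁅ suc e ⁆)

  matchingTerm-⊥ : ∀ {m} (x : Fin m → Carrier) → matchingTerm K x ⊥ ≈ 1#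
  matchingTerm-⊥ {zero} x = ≈-refl
  matchingTerm-⊥ {suc m} x = trans (*-identityˡ _) (matchingTerm-⊥ (x ∘ suc))

  matchingTerm-⁅⁆ : ∀ {m} (x : Fin m → Carrier) e → matchingTerm K x ⁅ e ⁆ ≈ - x e
  matchingTerm-⁅⁆ x zero = trans (*-congˡ (matchingTerm-⊥ (x ∘ suc))) (*-identityʳ _)
  matchingTerm-⁅⁆ x (suc e) = trans (*-identityˡ _) (matchingTerm-⁅⁆ (x ∘ suc) e)

  μ̃-commonVertex : ∀ {n m} (E : Fin m → Subset n) (c : Fin n) → (∀ e → c ∈ E e) →
    ∀ x → μ̃ K E x ≈ 1# - sumFin K x
  μ̃-commonVertex {m = m} E c c∈E x = begin
    μ̃ K E x
      ≈⟨ sumList-filter (matchingTerm K x) (isMatching E) (allSubsets m) ⟩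
    sumList (λ M → if isMatching E M then matchingTerm K x M else 0#) (allSubsets m)
      ≈⟨ sumList-cong (allSubsets m) (λ M → reflexive
           (cong (λ b → if b then matchingTerm K x M else 0#) (isMatching-commonVertex E c c∈E M))) ⟩
    sumList (λ M → if atMostOneᵇ M then matchingTerm K x M else 0#) (allSubsets m)
      ≈⟨ sumList-atMostOneᵇ (matchingTerm K x) ⟩
    matchingTerm K x ⊥ + sumFin K (λ e → matchingTerm K x ⁅ e ⁆)
      ≈⟨ +-cong (matchingTerm-⊥ x) (sumFin-cong (matchingTerm-⁅⁆ x)) ⟩
    1# + sumFin K (λ e → - x e)
      ≈⟨ +-congˡ (sumFin-neg x) ⟩
    1# - sumFin K x
      ∎

module StarWeights {r ℓ} (K : CommutativeRing r ℓ) {n m} (E : Fin m → Subset n)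
  (c : Fin n) (c∈E : ∀ e → c ∈ E e) (α : Fin m → CommutativeRing.Carrier K) where
  open CommutativeRing K hiding (zero) renaming (refl to ≈-refl)

  weights : Fin n → Fin m → Carrier
  weights v e = if lookup (E e) v then (if eqFin v c then α e else 1#) else 0#

  weights-isWeightedIncidence : ¬ (1# ≈ 0#) → (∀ e → ¬ (α e ≈ 0#)) →
    IsWeightedIncidence K E weights
  weights-isWeightedIncidence 1≉0 α≉0 v e = nonzero⇒∈ , ∈⇒nonzero
    where
    nonzero⇒∈ : ¬ (weights v e ≈ 0#) → v ∈ E e
    nonzero⇒∈ w≉0 with lookup (E e) v in v∈e
    ... | true = lookup⇒[]= v (E e) v∈e
    ... | false = ⊥-elim (w≉0 ≈-refl)
    ∈⇒nonzero : v ∈ E e → ¬ (weights v e ≈ 0#)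
    ∈⇒nonzero v∈e rewrite []=⇒lookup v∈e with eqFin v c
    ... | true = α≉0 e
    ... | false = 1≉0

  weights-centreSum : sumFin K α ≈ 1# →
    sumFin K (λ e → if lookup (E e) c then weights c e else 0#) ≈ 1#
  weights-centreSum Σα≈1 = trans (sumFin-cong K entry) Σα≈1
    where
    entry : ∀ e → (if lookup (E e) c then weights c e else 0#) ≈ α e
    entry e rewrite []=⇒lookup (c∈E e) | eqFin-refl c = ≈-refl

  weights-leafSum : ∀ {v e₀} → v ≢ c → v ∈ E e₀ → (∀ e → e ≢ e₀ → v ∉ E e) →
    sumFin K (λ e → if lookup (E e) v then weights v e else 0#) ≈ 1#
  weights-leafSum {v} {e₀} v≢c v∈e₀ v∉E = trans (sumFin-concentrated K e₀ _ elsewhere) atE₀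
    where
    atE₀ : (if lookup (E e₀) v then weights v e₀ else 0#) ≈ 1#
    atE₀ rewrite []=⇒lookup v∈e₀ | eqFin-≢ v c v≢c = ≈-refl
    elsewhere : ∀ e → e ≢ e₀ → (if lookup (E e) v then weights v e else 0#) ≈ 0#
    elsewhere e e≢e₀ with lookup (E e) v in v∈e
    ... | false = ≈-refl
    ... | true = ⊥-elim (v∉E e e≢e₀ (lookup⇒[]= v (E e) v∈e))

  weights-rowSum : (∀ v → ∃ λ e → v ∈ E e) →
    (∀ e f → e ≢ f → ∀ v → v ∈ E e → v ∈ E f → v ≡ c) → sumFin K α ≈ 1# →
    ∀ v → sumFin K (λ e → if lookup (E e) v then weights v e else 0#) ≈ 1#
  weights-rowSum cover petals Σα≈1 v with v ≟ c | cover v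
  ... | yes refl | _ = weights-centreSum Σα≈1
  ... | no v≢c | e₀ , v∈e₀ =
    weights-leafSum v≢c v∈e₀ λ e e≢e₀ v∈e → v≢c (petals e e₀ e≢e₀ v v∈e v∈e₀)

  weights-edgeProduct : ∀ e →
    prodFin K (λ v → if lookup (E e) v then weights v e else 1#) ≈ α e
  weights-edgeProduct e = trans (prodFin-concentrated K c _ elsewhere) atCentre
    where
    atCentre : (if lookup (E e) c then weights c e else 1#) ≈ α e
    atCentre rewrite []=⇒lookup (c∈E e) | eqFin-refl c = ≈-refl
    elsewhere : ∀ v → v ≢ c → (if lookup (E e) v then weights v e else 1#) ≈ 1#
    elsewhere v v≢c with lookup (E e) v
    ... | false = ≈-refl
    ... | true rewrite eqFin-≢ v c v≢c = ≈-refl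

lemma3p8 : {c ℓ : Level} (K : CommutativeRing c ℓ) → IsField K →
    (k n m : ℕ) → k ≥ 2 → (E : Fin m → Subset n) → IsKStar k n m E →
    (α : Fin m → CommutativeRing.Carrier K) →
    (∀ e → ¬ (CommutativeRing._≈_ K (α e) (CommutativeRing.0# K))) →
    CommutativeRing._≈_ K (μ̃ K E α) (CommutativeRing.0# K) →
    GeneralizedNormal K E α
lemma3p8 K isField _ _ _ _ E (_ , cover , c , c∈E , petals) α α≉0 root =
  weights
  , weights-isWeightedIncidence (IsField.1≉0 isField) α≉0
  , weights-rowSum cover petals Σα≈1
  , weights-edgeProduct
  where
  open CommutativeRing K
  open GroupProperties +-group using (x∙y⁻¹≈ε⇒x≈y)
  open StarWeights K E c c∈E α

  Σα≈1 : sumFin K α ≈ 1#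
  Σα≈1 = sym (x∙y⁻¹≈ε⇒x≈y 1# (sumFin K α) (trans (sym (μ̃-commonVertex K E c c∈E α)) root))
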